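{- Let $r>15$ be an odd integer and let $n$ be an even integer with $n < 3r+7$. Then every $r$-regular simple graph on $n$ vertices has a perfect matching.
   Context: All graphs are finite and simple. A perfect matching of a graph is a set of pairwise disjoint edges covering every vertex. -}

module Defs where

open import Data.Nat using (ℕ)
open import Data.Bool using (Bool; true; false)
open import Data.Fin using (Fin)
open import Data.Vec.Functional using (Vector)
open import Data.List using (List; filter; length)
open import Data.List.Base using (allFin)
open import Data.Bool using (T?)
open import Relation.Binary.PropositionalEquality using (_≡_; _≢_)
open import Data.Product using (Σ; _×_)

record SimpleGraph (n : ℕ) : Set where
  field
    Adj       : Fin n → Fin n → Bool
    symmetric : ∀ i j → Adj i j ≡ Adj j i
    loopless  : ∀ i → Adj i i ≡ false
open SimpleGraph public

degree : ∀ {n} → SimpleGraph n → Fin n → ℕ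
degree G v = length (filter (λ w → T? (Adj G v w)) (allFin _))

IsRegular : ∀ {n} → ℕ → SimpleGraph n → Set
IsRegular r G = ∀ v → degree G v ≡ r

-- The edges {v, partner v} are edges
-- of G, they are pairwise disjoint (partner is an involution) and cover all
-- vertices; conversely every perfect matching determines such a map.
record PerfectMatching {n : ℕ} (G : SimpleGraph n) : Set where
  field
    partner     : Fin n → Fin n
    isEdge      : ∀ v → Adj G v (partner v) ≡ true
    involutive  : ∀ v → partner (partner v) ≡ v

-- If G has no perfect matching, Tutte's theorem gives a set S such that G − S has more than |S|
-- odd components; the theorem is proved following Lovász, by induction on the number of non-edges.
-- If some non-universal b has neighbours a, c with ac a non-edge, pick d not adjacent to b; perfect
-- matchings of G + ac and G + bd that use these edges are recombined along the alternating walk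
-- through bd into one of G. Otherwise the non-universal vertices form disjoint cliques, and these
-- are matched up directly using the universal vertices, unless there are too many odd cliques.
--
-- For r-regular G with r odd, an odd component C sends an odd number of edges to S, at least r of
-- them when |C| ≤ r, while otherwise |C| ≥ r + 2. At most r|S| edges reach S and there are at least
-- |S| + 2 odd components, so S is nonempty and three components have at least r + 2 vertices:
-- n ≥ 1 + 3(r + 2) = 3r + 7.

module Submission where

open import Defs

import Algebra.Properties.Semiring.Sum as Sum
open import Data.Bool using (Bool; true; false; not; _∧_; _∨_; _xor_; if_then_else_; T; T?)
import Data.Bool
open import Data.Bool.Properties
  using (∨-zeroʳ; ∨-comm; ∧-comm; ∧-zeroʳ; ∧-conicalˡ; ∧-conicalʳ; not-involutive; not-injective; not-¬; ¬-not;
         not-distribˡ-xor; T-≡)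
open import Data.Empty using (⊥-elim)
open import Data.Fin using (Fin; zero; suc; toℕ; _≟_)
import Data.Fin.Properties as Finₚ
open import Data.List using (List; []; _∷_; _++_; length; filter; tabulate; allFin; concat; concatMap; take; drop)
open import Data.List.Membership.Propositional using (_∈_)
open import Data.List.Membership.Propositional.Properties using (∈-filter⁻; ∈-++⁻; ∈-++⁺ˡ; ∈-++⁺ʳ)
open import Data.List.Properties using (take++drop≡id; length-++)
open import Data.List.Relation.Unary.Any using (here; there)
open import Data.Maybe using (Maybe; just; nothing; fromMaybe)
import Data.Maybe as Maybe
open import Data.Nat using (ℕ; zero; suc; _<_; _≤_; _+_; _*_; z≤n; s≤s; _≤?_; _<ᵇ_)
open import Data.Nat.Divisibility using (_∣_; divides)
open import Data.Nat.Properties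
  using (+-*-semiring; +-commutativeSemigroup; *-commutativeSemigroup; module ≤-Reasoning;
         +-assoc; +-comm; +-identityʳ; +-suc; +-cancelˡ-≤; +-mono-≤; +-monoˡ-≤; +-monoʳ-≤; +-mono-<-≤; +-mono-≤-<;
         *-comm; *-identityˡ; *-identityʳ; *-zeroʳ; *-distribˡ-+; *-monoʳ-≤; *-cancelˡ-<;
         ≤-refl; ≤-reflexive; ≤-trans; ≤-pred; <-trans; <-≤-trans; ≤∧≢⇒<; ≮⇒≥; ≰⇒>; <⇒≱; n≮0; n<1+n; n≤1+n;
         m<m+n; m≤m+n; m≤n+m; m≤m*n; m<n⇒m<1+n; m≤n⇒m≤1+n; m≤n⇒m<n∨m≡n; m≤n⇒∃[o]m+o≡n; <ᵇ⇒<; <⇒<ᵇ)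
open import Data.Nat.Solver using (module +-*-Solver)
open import Data.Product using (_×_; _,_; proj₁; proj₂; ∃)
open import Data.Sum using (_⊎_; inj₁; inj₂; [_,_]′)
open import Function using (id; _∘_)
open import Function.Bundles using (Equivalence)
open import Relation.Binary.PropositionalEquality
open import Relation.Nullary using (¬_; Dec; yes; no; does)
open import Relation.Nullary.Decidable using (dec-true; dec-false; _⊎-dec_; _×-dec_; ¬?)

open import Algebra.Properties.CommutativeSemigroup +-commutativeSemigroup using (interchange)
open import Algebra.Properties.CommutativeSemigroup *-commutativeSemigroup using (x∙yz≈y∙xz)
open Sum +-*-semiring using (sum; ∑-distrib-+; ∑-comm; *-distribˡ-sum; sum-cong-≗)
open +-*-Solver using (solve; _:+_; _:*_; _:=_; con)

infix 7 _≡ᵇ_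

_≡ᵇ_ : ∀ {n} → Fin n → Fin n → Bool
i ≡ᵇ j = does (i ≟ j)

≡ᵇ-refl : ∀ {n} (i : Fin n) → (i ≡ᵇ i) ≡ true
≡ᵇ-refl i = dec-true (i ≟ i) refl

≢⇒≡ᵇ-false : ∀ {n} {i j : Fin n} → ¬ i ≡ j → (i ≡ᵇ j) ≡ false
≢⇒≡ᵇ-false {i = i} {j} = dec-false (i ≟ j)

≡ᵇ⇒≡ : ∀ {n} {i j : Fin n} → (i ≡ᵇ j) ≡ true → i ≡ j
≡ᵇ⇒≡ {i = i} {j} e with i ≟ j
... | yes i≡j = i≡j

≡ᵇ-sym : ∀ {n} (i j : Fin n) → (i ≡ᵇ j) ≡ (j ≡ᵇ i)
≡ᵇ-sym i j with i ≟ j | j ≟ i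
... | yes _ | yes _ = refl
... | no _ | no _ = refl
... | yes i≡j | no j≢i = ⊥-elim (j≢i (sym i≡j))
... | no i≢j | yes j≡i = ⊥-elim (i≢j (sym j≡i))

true≢false-at : ∀ {A : Set} (P : A → Bool) {u v} → P u ≡ true → P v ≡ false → ¬ u ≡ v
true≢false-at P Pu Pv refl with trans (sym Pu) Pv
... | ()

𝟙 : Bool → ℕ
𝟙 true = 1
𝟙 false = 0

𝟙≤1 : ∀ b → 𝟙 b ≤ 1
𝟙≤1 true = ≤-refl
𝟙≤1 false = z≤n

𝟙-∧ : ∀ a b → 𝟙 (a ∧ b) ≡ 𝟙 a * 𝟙 b
𝟙-∧ true b = sym (+-identityʳ (𝟙 b))
𝟙-∧ false b = refl

𝟙+𝟙-not : ∀ a → 𝟙 a + 𝟙 (not a) ≡ 1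
𝟙+𝟙-not true = refl
𝟙+𝟙-not false = refl

𝟙*-≤ : ∀ b x → 𝟙 b * x ≤ x
𝟙*-≤ true x = ≤-reflexive (+-identityʳ x)
𝟙*-≤ false x = z≤n

∑-mono-≤ : ∀ {n} {f g : Fin n → ℕ} → (∀ i → f i ≤ g i) → sum f ≤ sum g
∑-mono-≤ {zero} f≤g = z≤n
∑-mono-≤ {suc n} f≤g = +-mono-≤ (f≤g zero) (∑-mono-≤ (f≤g ∘ suc))

∑-mono-< : ∀ {n} {f g : Fin n → ℕ} → (∀ i → f i ≤ g i) → ∀ x → f x < g x → sum f < sum g
∑-mono-< {suc n} f≤g zero lt = +-mono-<-≤ lt (∑-mono-≤ (f≤g ∘ suc))
∑-mono-< {suc n} f≤g (suc x) lt = +-mono-≤-< (f≤g zero) (∑-mono-< (f≤g ∘ suc) x lt)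

∑-*ʳ : ∀ {n} (f : Fin n → ℕ) c → sum (λ i → f i * c) ≡ sum f * c
∑-*ʳ f c = begin
  sum (λ i → f i * c)  ≡⟨ sum-cong-≗ (λ i → *-comm (f i) c) ⟩
  sum (λ i → c * f i)  ≡⟨ *-distribˡ-sum c f ⟨
  c * sum f            ≡⟨ *-comm c (sum f) ⟩
  sum f * c            ∎
  where open ≡-Reasoning

∑-zero : ∀ n → sum {n} (λ _ → 0) ≡ 0
∑-zero zero = refl
∑-zero (suc n) = ∑-zero n

∑-one : ∀ n → sum {n} (λ _ → 1) ≡ n
∑-one zero = refl
∑-one (suc n) = cong suc (∑-one n)

∑-δ : ∀ {n} (t : Fin n) → sum (λ i → 𝟙 (i ≡ᵇ t)) ≡ 1
∑-δ {suc n} zero = cong suc (trans (sum-cong-≗ {n} (λ i → cong 𝟙 (≢⇒≡ᵇ-false {i = suc i} {zero} λ ()))) (∑-zero n))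
∑-δ {suc n} (suc t) = trans (sum-cong-≗ (λ i → cong 𝟙 (suc≡ᵇsuc i))) (∑-δ t)
  where
  suc≡ᵇsuc : ∀ i → (suc i ≡ᵇ suc t) ≡ (i ≡ᵇ t)
  suc≡ᵇsuc i with i ≟ t
  ... | yes _ = refl
  ... | no _ = refl

isOdd : ℕ → Bool
isOdd zero = false
isOdd (suc n) = not (isOdd n)

isOdd-+ : ∀ m n → isOdd (m + n) ≡ isOdd m xor isOdd n
isOdd-+ zero n = refl
isOdd-+ (suc m) n = trans (cong not (isOdd-+ m n)) (not-distribˡ-xor (isOdd m) (isOdd n))

isOdd-* : ∀ m n → isOdd (m * n) ≡ isOdd m ∧ isOdd n
isOdd-* zero n = refl
isOdd-* (suc m) n rewrite isOdd-+ n (m * n) | isOdd-* m n with isOdd m | isOdd n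
... | true | true = refl
... | true | false = refl
... | false | true = refl
... | false | false = refl

isOdd-𝟙 : ∀ b → isOdd (𝟙 b) ≡ b
isOdd-𝟙 true = refl
isOdd-𝟙 false = refl

isOdd-+-double : ∀ m n → isOdd (m + (m + n)) ≡ isOdd n
isOdd-+-double m n rewrite isOdd-+ m (m + n) | isOdd-+ m n with isOdd m
... | true = not-involutive (isOdd n)
... | false = refl

isOdd-∑ : ∀ {n} (f : Fin n → ℕ) → isOdd (sum f) ≡ isOdd (sum (𝟙 ∘ isOdd ∘ f))
isOdd-∑ {zero} f = refl
isOdd-∑ {suc n} f rewrite isOdd-+ (f zero) (sum (f ∘ suc))
                        | isOdd-+ (𝟙 (isOdd (f zero))) (sum (𝟙 ∘ isOdd ∘ f ∘ suc))
                        | isOdd-𝟙 (isOdd (f zero)) | isOdd-∑ (f ∘ suc) = refl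

xor≡false⇒≡ : ∀ {x y} → x xor y ≡ false → x ≡ y
xor≡false⇒≡ {true} {true} _ = refl
xor≡false⇒≡ {false} {false} _ = refl

isOdd⇒0< : ∀ {n} → isOdd n ≡ true → 1 ≤ n
isOdd⇒0< {suc n} _ = s≤s z≤n

2∣⇒isOdd≡false : ∀ {m} → 2 ∣ m → isOdd m ≡ false
2∣⇒isOdd≡false (divides q refl) = even q
  where
  even : ∀ q → isOdd (q * 2) ≡ false
  even zero = refl
  even (suc q) = trans (not-involutive (isOdd (q * 2))) (even q)

isOdd≡false⇒2∣ : ∀ m → isOdd m ≡ false → 2 ∣ m
isOdd≡false⇒2∣ zero _ = divides 0 refl
isOdd≡false⇒2∣ (suc (suc m)) e with isOdd≡false⇒2∣ m (trans (sym (not-involutive (isOdd m))) e)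
... | divides q refl = divides (suc q) refl

¬2∣⇒isOdd : ∀ {m} → ¬ 2 ∣ m → isOdd m ≡ true
¬2∣⇒isOdd {m} ¬2∣m = ¬-not (¬2∣m ∘ isOdd≡false⇒2∣ m)

∑∑-symmetric-even : ∀ {n} (M : Fin n → Fin n → ℕ) → (∀ i j → M i j ≡ M j i) → (∀ i → M i i ≡ 0) →
                    isOdd (sum λ i → sum λ j → M i j) ≡ false
∑∑-symmetric-even {zero} M _ _ = refl
∑∑-symmetric-even {suc n} M M-sym M-diag = begin
  isOdd (sum λ i → sum λ j → M i j)  ≡⟨ cong isOdd first-row-and-column ⟩
  isOdd (R + (R + I))                ≡⟨ isOdd-+-double R I ⟩
  isOdd I                            ≡⟨ ∑∑-symmetric-even (λ i j → M (suc i) (suc j)) (λ i j → M-sym _ _) (M-diag ∘ suc) ⟩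
  false                              ∎
  where
  open ≡-Reasoning
  R = sum λ j → M zero (suc j)
  I = sum λ i → sum λ j → M (suc i) (suc j)
  first-row-and-column : (sum λ i → sum λ j → M i j) ≡ R + (R + I)
  first-row-and-column = cong₂ _+_ (cong (_+ R) (M-diag zero))
    (trans (∑-distrib-+ (λ i → M (suc i) zero) _) (cong (_+ I) (sum-cong-≗ (λ i → M-sym (suc i) zero))))

length-filter-tabulate : ∀ {A : Set} {n} (P : A → Bool) (f : Fin n → A) →
                         length (filter (T? ∘ P) (tabulate f)) ≡ sum (𝟙 ∘ P ∘ f)
length-filter-tabulate {n = zero} P f = refl
length-filter-tabulate {n = suc n} P f with P (f zero)
... | true = cong suc (length-filter-tabulate P (f ∘ suc))
... | false = length-filter-tabulate P (f ∘ suc)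

degree≡∑ : ∀ {n} (G : SimpleGraph n) v → degree G v ≡ sum (λ w → 𝟙 (Adj G v w))
degree≡∑ G v = length-filter-tabulate (Adj G v) id

module _ {n} (G : SimpleGraph n) where

  addEdgeAdj : Fin n → Fin n → Fin n → Fin n → Bool
  addEdgeAdj x y u v = Adj G u v ∨ ((u ≡ᵇ x ∧ v ≡ᵇ y) ∨ (u ≡ᵇ y ∧ v ≡ᵇ x))

  addEdge : (x y : Fin n) → ¬ x ≡ y → SimpleGraph n
  addEdge x y x≢y = record
    { Adj = addEdgeAdj x y
    ; symmetric = λ u v → cong₂ _∨_ (symmetric G u v)
        (trans (∨-comm (u ≡ᵇ x ∧ v ≡ᵇ y) (u ≡ᵇ y ∧ v ≡ᵇ x))
               (cong₂ _∨_ (∧-comm (u ≡ᵇ y) (v ≡ᵇ x)) (∧-comm (u ≡ᵇ x) (v ≡ᵇ y))))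
    ; loopless = addEdge-loopless
    }
    where
    addEdge-loopless : ∀ u → addEdgeAdj x y u u ≡ false
    addEdge-loopless u rewrite loopless G u with u ≟ x | u ≟ y
    ... | yes refl | yes refl = ⊥-elim (x≢y refl)
    ... | yes _ | no _ = refl
    ... | no _ | yes _ = refl
    ... | no _ | no _ = refl

  module _ {x y : Fin n} where

    addEdge-⊇ : ∀ {u v} → Adj G u v ≡ true → addEdgeAdj x y u v ≡ true
    addEdge-⊇ e = cong (_∨ _) e

    addEdge-⊆ : ∀ {u v} → addEdgeAdj x y u v ≡ true →
                ¬ (u ≡ x × v ≡ y) → ¬ (u ≡ y × v ≡ x) → Adj G u v ≡ true
    addEdge-⊆ {u} {v} e ¬xy ¬yx with Adj G u v | u ≟ x | v ≟ y | u ≟ y | v ≟ x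
    ... | true | _ | _ | _ | _ = refl
    ... | false | yes u≡x | yes v≡y | _ | _ = ⊥-elim (¬xy (u≡x , v≡y))
    ... | false | _ | _ | yes u≡y | yes v≡x = ⊥-elim (¬yx (u≡y , v≡x))
    ... | false | no _ | _ | no _ | _ = e
    ... | false | no _ | _ | yes _ | no _ = e
    ... | false | yes _ | no _ | no _ | _ = e
    ... | false | yes _ | no _ | yes _ | no _ = e

    addEdge-⊆-away : ∀ {u v} → addEdgeAdj x y u v ≡ true → ¬ u ≡ x → ¬ u ≡ y → Adj G u v ≡ true
    addEdge-⊆-away e u≢x u≢y = addEdge-⊆ e (u≢x ∘ proj₁) (u≢y ∘ proj₁)

  nonEdgeCount : ℕ
  nonEdgeCount = sum λ u → sum λ v → 𝟙 (not (u ≡ᵇ v) ∧ not (Adj G u v))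

nonEdgeCount-addEdge : ∀ {n} (G : SimpleGraph n) {x y} (x≢y : ¬ x ≡ y) → Adj G x y ≡ false →
                       nonEdgeCount (addEdge G x y x≢y) < nonEdgeCount G
nonEdgeCount-addEdge G {x} {y} x≢y ¬xy =
  ∑-mono-< (λ u → ∑-mono-≤ (pointwise u)) x (∑-mono-< (pointwise x) y at-xy)
  where
  pointwise : ∀ u v → 𝟙 (not (u ≡ᵇ v) ∧ not (addEdgeAdj G x y u v)) ≤ 𝟙 (not (u ≡ᵇ v) ∧ not (Adj G u v))
  pointwise u v with u ≡ᵇ v | Adj G u v | (u ≡ᵇ x ∧ v ≡ᵇ y) ∨ (u ≡ᵇ y ∧ v ≡ᵇ x)
  ... | true | _ | _ = z≤n
  ... | false | true | _ = z≤n
  ... | false | false | true = z≤n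
  ... | false | false | false = ≤-refl
  at-xy : 𝟙 (not (x ≡ᵇ y) ∧ not (addEdgeAdj G x y x y)) < 𝟙 (not (x ≡ᵇ y) ∧ not (Adj G x y))
  at-xy rewrite ≢⇒≡ᵇ-false x≢y | ¬xy | ≡ᵇ-refl x | ≡ᵇ-refl y = ≤-refl

module _ {n} {G : SimpleGraph n} (M : PerfectMatching G) where
  open PerfectMatching M

  partner-≢ : ∀ v → ¬ partner v ≡ v
  partner-≢ v pv≡v with trans (sym (isEdge v)) (trans (cong (Adj G v) pv≡v) (loopless G v))
  ... | ()

perfectMatching-addEdge⁻ : ∀ {n} (G : SimpleGraph n) {x y} {x≢y : ¬ x ≡ y} (M : PerfectMatching (addEdge G x y x≢y)) →
                           ¬ PerfectMatching.partner M x ≡ y → PerfectMatching G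
perfectMatching-addEdge⁻ G M px≢y = record { partner = partner ; isEdge = isEdge′ ; involutive = involutive }
  where
  open PerfectMatching M
  isEdge′ : ∀ v → Adj G v (partner v) ≡ true
  isEdge′ v = addEdge-⊆ G (isEdge v)
    (λ { (refl , e) → px≢y e })
    (λ { (refl , e) → px≢y (trans (cong partner (sym e)) (involutive v)) })

card : ∀ {n} → (Fin n → Bool) → ℕ
card S = sum (𝟙 ∘ S)

module _ {n} (S : Fin n → Bool) (label : Fin n → Fin n) where

  inClass : Fin n → Fin n → Bool
  inClass i v = not (S v) ∧ label v ≡ᵇ i

  inClass⇒ : ∀ {i v} → inClass i v ≡ true → (S v ≡ false) × (label v ≡ i)
  inClass⇒ {i} {v} e with S v | label v ≟ i
  ... | false | yes lv≡i = refl , lv≡i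

  classSize : Fin n → ℕ
  classSize i = card (inClass i)

  oddClassCount : ℕ
  oddClassCount = sum λ i → 𝟙 (isOdd (classSize i))

  inClass-unique : ∀ v → sum (λ i → 𝟙 (inClass i v)) ≡ 𝟙 (not (S v))
  inClass-unique v = begin
    sum (λ i → 𝟙 (inClass i v))                    ≡⟨ sum-cong-≗ (λ i → 𝟙-∧ (not (S v)) (label v ≡ᵇ i)) ⟩
    sum (λ i → 𝟙 (not (S v)) * 𝟙 (label v ≡ᵇ i))  ≡⟨ *-distribˡ-sum {n} (𝟙 (not (S v))) _ ⟨
    𝟙 (not (S v)) * sum (λ i → 𝟙 (label v ≡ᵇ i))  ≡⟨ cong (𝟙 (not (S v)) *_) (trans (sum-cong-≗ δ-sym) (∑-δ (label v))) ⟩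
    𝟙 (not (S v)) * 1                              ≡⟨ *-identityʳ _ ⟩
    𝟙 (not (S v))                                  ∎
    where
    open ≡-Reasoning
    δ-sym : ∀ i → 𝟙 (label v ≡ᵇ i) ≡ 𝟙 (i ≡ᵇ label v)
    δ-sym i = cong 𝟙 (≡ᵇ-sym (label v) i)

  card+∑classSize : card S + sum classSize ≡ n
  card+∑classSize = begin
    card S + sum classSize                                 ≡⟨ cong (card S +_) (∑-comm (λ i v → 𝟙 (inClass i v))) ⟩
    card S + sum (λ v → sum λ i → 𝟙 (inClass i v))         ≡⟨ cong (card S +_) (sum-cong-≗ inClass-unique) ⟩
    card S + sum (λ v → 𝟙 (not (S v)))                     ≡⟨ ∑-distrib-+ (𝟙 ∘ S) _ ⟨
    sum (λ v → 𝟙 (S v) + 𝟙 (not (S v)))                    ≡⟨ sum-cong-≗ (𝟙+𝟙-not ∘ S) ⟩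
    sum {n} (λ _ → 1)                                      ≡⟨ ∑-one n ⟩
    n                                                      ∎
    where open ≡-Reasoning

  isOdd-card+oddClassCount : isOdd n ≡ isOdd (card S) xor isOdd oddClassCount
  isOdd-card+oddClassCount = begin
    isOdd n                                          ≡⟨ cong isOdd card+∑classSize ⟨
    isOdd (card S + sum classSize)                   ≡⟨ isOdd-+ (card S) _ ⟩
    isOdd (card S) xor isOdd (sum classSize)         ≡⟨ cong (isOdd (card S) xor_) (isOdd-∑ classSize) ⟩
    isOdd (card S) xor isOdd oddClassCount           ∎
    where open ≡-Reasoning

-- Tutte's obstruction, with components of G − S relaxed to the classes of a labelling that is
-- constant along edges of G − S; an odd class contains an odd component, so this is no weaker.
record Barrier {n} (G : SimpleGraph n) : Set where
  field
    S : Fin n → Bool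
    label : Fin n → Fin n
    label-edge : ∀ u v → S u ≡ false → S v ≡ false → Adj G u v ≡ true → label u ≡ label v
    card<oddClassCount : card S < oddClassCount S label

barrier-addEdge⁻ : ∀ {n} (G : SimpleGraph n) {x y} {x≢y : ¬ x ≡ y} → Barrier (addEdge G x y x≢y) → Barrier G
barrier-addEdge⁻ G B = record
  { S = S ; label = label
  ; label-edge = λ u v su sv e → label-edge u v su sv (addEdge-⊇ G e)
  ; card<oddClassCount = card<oddClassCount }
  where open Barrier B

-- Splicing perfect matchings

module _ {n} (G : SimpleGraph n) (W : Fin n → Bool) (p q : Fin n → Fin n)
  (p-closed : ∀ {v} → W v ≡ true → W (p v) ≡ true) (p-involutive : ∀ {v} → W v ≡ true → p (p v) ≡ v)
  (p-edge : ∀ {v} → W v ≡ true → Adj G v (p v) ≡ true)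
  (q-closed : ∀ {v} → W v ≡ true → W (q v) ≡ true) (q-involutive : ∀ v → q (q v) ≡ v)
  (q-edge : ∀ {v} → W v ≡ false → Adj G v (q v) ≡ true) where

  private
    q-closed-outside : ∀ {v} → W v ≡ false → W (q v) ≡ false
    q-closed-outside {v} ¬Wv with W (q v) in Wqv
    ... | false = refl
    ... | true = trans (sym (subst (λ u → W u ≡ true) (q-involutive v) (q-closed Wqv))) ¬Wv

    partner : Fin n → Fin n
    partner v = if W v then p v else q v

  splice : PerfectMatching G
  splice = record { partner = partner ; isEdge = isEdge ; involutive = involutive }
    where
    isEdge : ∀ v → Adj G v (partner v) ≡ true
    isEdge v with W v in Wv
    ... | true = p-edge Wv
    ... | false = q-edge Wv
    involutive : ∀ v → partner (partner v) ≡ v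
    involutive v with W v in Wv
    ... | true rewrite p-closed Wv = p-involutive Wv
    ... | false rewrite q-closed-outside Wv = q-involutive v

module _ {n} (f : ℕ → Fin n) where

  inPrefix : ℕ → Fin n → Bool
  inPrefix zero v = f zero ≡ᵇ v
  inPrefix (suc m) v = f (suc m) ≡ᵇ v ∨ inPrefix m v

  inPrefix-intro : ∀ {i v} m → i ≤ m → f i ≡ v → inPrefix m v ≡ true
  inPrefix-intro zero z≤n refl = ≡ᵇ-refl (f zero)
  inPrefix-intro {i} (suc m) i≤1+m refl with m≤n⇒m<n∨m≡n i≤1+m
  ... | inj₁ i<1+m rewrite inPrefix-intro m (≤-pred i<1+m) refl = ∨-zeroʳ _
  ... | inj₂ refl rewrite ≡ᵇ-refl (f (suc m)) = refl

  inPrefix-elim : ∀ m {v} → inPrefix m v ≡ true → ∃ λ i → i ≤ m × f i ≡ v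
  inPrefix-elim zero e = zero , z≤n , ≡ᵇ⇒≡ e
  inPrefix-elim (suc m) {v} e with f (suc m) ≡ᵇ v in e′
  ... | true = suc m , ≤-refl , ≡ᵇ⇒≡ e′
  ... | false = let (i , i≤m , fi≡v) = inPrefix-elim m e in i , m≤n⇒m≤1+n i≤m , fi≡v

first-≤ : ∀ {p} {P : ℕ → Set p} → (∀ m → Dec (P m)) → ∀ N →
          (∃ λ k → k ≤ N × P k × (∀ {j} → j < k → ¬ P j)) ⊎ (∀ {m} → m ≤ N → ¬ P m)
first-≤ P? zero with P? zero
... | yes p = inj₁ (zero , z≤n , p , λ ())
... | no ¬p = inj₂ λ { z≤n → ¬p }
first-≤ P? (suc N) with first-≤ P? N
... | inj₁ (k , k≤N , p , before) = inj₁ (k , m≤n⇒m≤1+n k≤N , p , before)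
... | inj₂ none with P? (suc N)
...   | yes p = inj₁ (suc N , ≤-refl , p , λ j<1+N → none (≤-pred j<1+N))
...   | no ¬p = inj₂ λ m≤1+N → [ none ∘ ≤-pred , (λ { refl → ¬p }) ]′ (m≤n⇒m<n∨m≡n m≤1+N)

-- Lovász's exchange step

module Exchange {n} (G : SimpleGraph n) {a b c d : Fin n} {a≢c : ¬ a ≡ c} {b≢d : ¬ b ≡ d}
  (ab : Adj G a b ≡ true) (bc : Adj G b c ≡ true)
  (M₁ : PerfectMatching (addEdge G a c a≢c)) (M₂ : PerfectMatching (addEdge G b d b≢d))
  (p₁a≡c : PerfectMatching.partner M₁ a ≡ c) (p₂b≡d : PerfectMatching.partner M₂ b ≡ d) where

  open PerfectMatching M₁ using () renaming (partner to p₁; isEdge to p₁-edge; involutive to p₁-involutive)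
  open PerfectMatching M₂ using () renaming (partner to p₂; isEdge to p₂-edge; involutive to p₂-involutive)

  b≢a : ¬ b ≡ a
  b≢a refl with trans (sym ab) (loopless G b)
  ... | ()

  b≢c : ¬ b ≡ c
  b≢c refl with trans (sym bc) (loopless G b)
  ... | ()

  p₁c≡a : p₁ c ≡ a
  p₁c≡a = trans (cong p₁ (sym p₁a≡c)) (p₁-involutive a)

  step : Bool → Fin n → Fin n
  step true = p₁
  step false = p₂

  step-involutive : ∀ t v → step t (step t v) ≡ v
  step-involutive true = p₁-involutive
  step-involutive false = p₂-involutive

  step-≢ : ∀ t v → ¬ step t v ≡ v
  step-≢ true = partner-≢ M₁
  step-≢ false = partner-≢ M₂

  -- b, d = p₂ b, p₁ d, p₂ (p₁ d), … : the alternating walk of M₁ and M₂ through the edge bd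
  walk : ℕ → Fin n
  walk zero = b
  walk (suc i) = step (isOdd i) (walk i)

  walk-next : ∀ i {t} → isOdd i ≡ t → step t (walk i) ≡ walk (suc i)
  walk-next i refl = refl

  walk-prev : ∀ i {t} → isOdd i ≡ t → step t (walk (suc i)) ≡ walk i
  walk-prev i refl = step-involutive (isOdd i) (walk i)

  -- Where the partner of walk i in M₁ (t = true) or M₂ (t = false) lies on the walk.
  data Located : Bool → ℕ → Set where
    next : ∀ {t i} → isOdd i ≡ t → Located t i
    prev : ∀ {t i} → isOdd i ≡ t → Located t (suc i)
    start : Located true zero

  locate : ∀ t i → Located t i
  locate false zero = next refl
  locate true zero = start
  locate t (suc i) with isOdd i Data.Bool.≟ t
  ... | yes e = prev e
  ... | no ne = next (sym (¬-not (ne ∘ sym)))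

  InjectiveUpTo : ℕ → Set
  InjectiveUpTo j = ∀ {i i′} → i < i′ → i′ ≤ j → ¬ walk i ≡ walk i′

  -- Stepping back from a repetition walk (1 + i) ≡ walk (1 + j) yields an earlier one.
  walk-fresh : ∀ j → InjectiveUpTo j → ¬ walk (suc j) ≡ b → ∀ {i} → i ≤ j → ¬ walk i ≡ walk (suc j)
  walk-fresh j inj ¬b {zero} _ = ¬b ∘ sym
  walk-fresh j inj ¬b {suc i} 1+i≤j e with m≤n⇒m<n∨m≡n 1+i≤j | locate (isOdd j) (suc i)
  ... | inj₂ refl | _ = step-≢ (isOdd (suc i)) (walk (suc i)) (sym e)
  ... | inj₁ 1+i<j | prev same = inj (<-trans (n<1+n i) 1+i<j) ≤-refl
        (trans (sym (walk-prev i same)) (trans (cong (step (isOdd j)) e) (walk-prev j refl)))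
  ... | inj₁ 1+i<j | next parity with m≤n⇒m<n∨m≡n 1+i<j
  ...   | inj₁ 2+i<j = inj 2+i<j ≤-refl
          (trans (sym (walk-next (suc i) parity)) (trans (cong (step (isOdd j)) e) (walk-prev j refl)))
  ...   | inj₂ refl = not-¬ refl parity

  walk-injective : ∀ j → (∀ {m} → m < j → ¬ walk (suc m) ≡ b) → InjectiveUpTo j
  walk-injective zero _ i<i′ i′≤0 = ⊥-elim (n≮0 (<-≤-trans i<i′ i′≤0))
  walk-injective (suc j) no-return {i} {i′} i<i′ i′≤1+j with m≤n⇒m<n∨m≡n i′≤1+j
  ... | inj₁ i′<1+j = walk-injective j (no-return ∘ m<n⇒m<1+n) i<i′ (≤-pred i′<1+j)
  ... | inj₂ refl = walk-fresh j (walk-injective j (no-return ∘ m<n⇒m<1+n)) (no-return (n<1+n j)) (≤-pred i<i′)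

  walk-not-injective : ∀ j → n ≤ j → ¬ InjectiveUpTo j
  walk-not-injective j n≤j inj with Finₚ.pigeonhole (n<1+n n) (walk ∘ toℕ)
  ... | i , i′ , i<i′ , e = inj i<i′ (≤-trans (≤-pred (Finₚ.toℕ<n i′)) n≤j) e

  p₂-edge-outside : (W : Fin n → Bool) → W b ≡ true → W d ≡ true → ∀ {v} → W v ≡ false → Adj G v (p₂ v) ≡ true
  p₂-edge-outside W Wb Wd {v} ¬Wv =
    addEdge-⊆-away G (p₂-edge v) (true≢false-at W Wb ¬Wv ∘ sym) (true≢false-at W Wd ¬Wv ∘ sym)

  Hit : Fin n → Set
  Hit v = v ≡ a ⊎ v ≡ b ⊎ v ≡ c

  hit? : ∀ v → Dec (Hit v)
  hit? v = v ≟ a ⊎-dec (v ≟ b ⊎-dec v ≟ c)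

  module FirstHit (k₀ : ℕ) (before : ∀ {m} → m < k₀ → ¬ Hit (walk (suc m))) where

    injective : InjectiveUpTo k₀
    injective = walk-injective k₀ (λ m<k₀ e → before m<k₀ (inj₂ (inj₁ e)))

    -- The walk closes into an alternating cycle through bd avoiding a and c:
    -- use M₁ on the cycle and M₂ elsewhere.
    module ReturnsToB (returns : walk (suc k₀) ≡ b) where

      k₀-odd : isOdd k₀ ≡ true
      k₀-odd = ¬-not λ e → d-only-first k₀ ≤-refl e (trans (sym (walk-prev k₀ e)) (trans (cong p₂ returns) p₂b≡d))
        where
        d-only-first : ∀ j → j ≤ k₀ → isOdd j ≡ false → ¬ walk j ≡ d
        d-only-first zero _ _ = b≢d
        d-only-first (suc (suc j)) j≤k₀ _ e′ = injective (s≤s (s≤s z≤n)) j≤k₀ (trans p₂b≡d (sym e′))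

      W : Fin n → Bool
      W = inPrefix walk k₀

      W-walk : ∀ {j v} → j ≤ suc k₀ → walk j ≡ v → W v ≡ true
      W-walk j≤1+k₀ e with m≤n⇒m<n∨m≡n j≤1+k₀
      ... | inj₁ j<1+k₀ = inPrefix-intro walk k₀ (≤-pred j<1+k₀) e
      ... | inj₂ refl = inPrefix-intro walk k₀ z≤n (trans (sym returns) e)

      W-closed : ∀ t {v} → W v ≡ true → W (step t v) ≡ true
      W-closed t Wv with inPrefix-elim walk k₀ Wv
      ... | i , i≤k₀ , refl with locate t i
      ...   | next e = W-walk (s≤s i≤k₀) (sym (walk-next i e))
      ...   | prev {i = i₀} e = W-walk (≤-trans (n≤1+n i₀) (m≤n⇒m≤1+n i≤k₀)) (sym (walk-prev i₀ e))
      ...   | start = W-walk (n≤1+n k₀) (trans (sym (walk-prev k₀ k₀-odd)) (cong p₁ returns))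

      W-avoids : ∀ {v} → W v ≡ true → (¬ v ≡ a) × (¬ v ≡ c)
      W-avoids Wv with inPrefix-elim walk k₀ Wv
      ... | zero , _ , refl = b≢a , b≢c
      ... | suc m , 1+m≤k₀ , refl = before 1+m≤k₀ ∘ inj₁ , before 1+m≤k₀ ∘ inj₂ ∘ inj₂

      matching : PerfectMatching G
      matching = splice G W p₁ p₂ (W-closed true) (λ {v} _ → p₁-involutive v) p₁-edge′
                   (W-closed false) p₂-involutive (p₂-edge-outside W (W-walk z≤n refl) (W-walk (s≤s z≤n) p₂b≡d))
        where
        p₁-edge′ : ∀ {v} → W v ≡ true → Adj G v (p₁ v) ≡ true
        p₁-edge′ {v} Wv = addEdge-⊆-away G (p₁-edge v) (proj₁ (W-avoids Wv)) (proj₂ (W-avoids Wv))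

    -- The walk b, d, …, a′ first meets {a, c} at a′: match a′ with b, use M₁ on the
    -- interior of the walk and M₂ elsewhere.
    module ReachesAC {a′ c′ : Fin n} (a′-hit : a′ ≡ a ⊎ a′ ≡ c) (c′-hit : c′ ≡ a ⊎ c′ ≡ c)
      (p₁a′≡c′ : p₁ a′ ≡ c′) (a′b : Adj G a′ b ≡ true) (reaches : walk (suc k₀) ≡ a′) where

      k = suc k₀

      avoids-ac : ∀ {m v} → m < k₀ → v ≡ a ⊎ v ≡ c → ¬ walk (suc m) ≡ v
      avoids-ac m<k₀ v-hit e = before m<k₀ ([ inj₁ ∘ trans e , inj₂ ∘ inj₂ ∘ trans e ]′ v-hit)

      ac-≢b : ∀ {v} → v ≡ a ⊎ v ≡ c → ¬ v ≡ b
      ac-≢b (inj₁ refl) = b≢a ∘ sym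
      ac-≢b (inj₂ refl) = b≢c ∘ sym

      k₀-even : isOdd k₀ ≡ false
      k₀-even = ¬-not λ e → c′-only-last k₀ ≤-refl (trans (sym (walk-prev k₀ e)) (trans (cong p₁ reaches) p₁a′≡c′))
        where
        c′-only-last : ∀ j → j ≤ k₀ → ¬ walk j ≡ c′
        c′-only-last zero _ = ac-≢b c′-hit ∘ sym
        c′-only-last (suc m) 1+m≤k₀ = avoids-ac 1+m≤k₀ c′-hit

      k-odd : isOdd k ≡ true
      k-odd = cong not k₀-even

      W : Fin n → Bool
      W = inPrefix walk k

      Inner : Fin n → Set
      Inner v = ∃ λ m → m < k₀ × walk (suc m) ≡ v

      inner-of : ∀ {v} → W v ≡ true → ¬ v ≡ a′ → ¬ v ≡ b → Inner v
      inner-of Wv v≢a′ v≢b with inPrefix-elim walk k Wv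
      ... | zero , _ , refl = ⊥-elim (v≢b refl)
      ... | suc m , 1+m≤k , refl with m≤n⇒m<n∨m≡n (≤-pred 1+m≤k)
      ...   | inj₁ m<k₀ = m , m<k₀ , refl
      ...   | inj₂ refl = ⊥-elim (v≢a′ reaches)

      inner-p₁ : ∀ {v} → Inner v → Inner (p₁ v)
      inner-p₁ (m , m<k₀ , refl) with locate true (suc m)
      ... | next e = suc m , ≤∧≢⇒< m<k₀ (true≢false-at isOdd e k₀-even) , sym (walk-next (suc m) e)
      ... | prev {i = suc m′} e = m′ , ≤-trans (n≤1+n (suc m′)) m<k₀ , sym (walk-prev (suc m′) e)

      inner-avoids : ∀ {v} → Inner v → (¬ v ≡ a) × (¬ v ≡ c) × (¬ v ≡ a′) × (¬ v ≡ b)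
      inner-avoids (m , m<k₀ , refl) =
        avoids-ac m<k₀ (inj₁ refl) , avoids-ac m<k₀ (inj₂ refl) , avoids-ac m<k₀ a′-hit , before m<k₀ ∘ inj₂ ∘ inj₁

      W-walk : ∀ {j v} → j ≤ k → walk j ≡ v → W v ≡ true
      W-walk = inPrefix-intro walk k

      W-inner : ∀ {v} → Inner v → W v ≡ true
      W-inner (m , m<k₀ , e) = W-walk (m≤n⇒m≤1+n m<k₀) e

      W-closed-p₂ : ∀ {v} → W v ≡ true → W (p₂ v) ≡ true
      W-closed-p₂ Wv with inPrefix-elim walk k Wv
      ... | i , i≤k , refl with locate false i
      ...   | next e = W-walk (≤∧≢⇒< i≤k (true≢false-at isOdd k-odd e ∘ sym)) (sym (walk-next i e))
      ...   | prev {i = i₀} e = W-walk (≤-trans (n≤1+n i₀) i≤k) (sym (walk-prev i₀ e))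

      swap : Fin n → Fin n
      swap v with v ≟ a′ | v ≟ b
      ... | yes _ | _ = b
      ... | no _ | yes _ = a′
      ... | no _ | no _ = p₁ v

      swap-a′ : swap a′ ≡ b
      swap-a′ with a′ ≟ a′ | a′ ≟ b
      ... | yes _ | _ = refl
      ... | no a′≢a′ | _ = ⊥-elim (a′≢a′ refl)

      swap-b : swap b ≡ a′
      swap-b with b ≟ a′ | b ≟ b
      ... | yes b≡a′ | _ = ⊥-elim (ac-≢b a′-hit (sym b≡a′))
      ... | no _ | yes _ = refl
      ... | no _ | no b≢b = ⊥-elim (b≢b refl)

      swap-inner : ∀ {v} → Inner v → swap v ≡ p₁ v
      swap-inner {v} inner with v ≟ a′ | v ≟ b
      ... | yes v≡a′ | _ = ⊥-elim (proj₁ (proj₂ (proj₂ (inner-avoids inner))) v≡a′)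
      ... | no _ | yes v≡b = ⊥-elim (proj₂ (proj₂ (proj₂ (inner-avoids inner))) v≡b)
      ... | no _ | no _ = refl

      W-closed-swap : ∀ {v} → W v ≡ true → W (swap v) ≡ true
      W-closed-swap {v} Wv with v ≟ a′ | v ≟ b
      ... | yes _ | _ = W-walk z≤n refl
      ... | no _ | yes _ = W-walk ≤-refl reaches
      ... | no v≢a′ | no v≢b = W-inner (inner-p₁ (inner-of Wv v≢a′ v≢b))

      swap-involutive : ∀ {v} → W v ≡ true → swap (swap v) ≡ v
      swap-involutive {v} Wv with v ≟ a′ | v ≟ b
      ... | yes refl | _ = swap-b
      ... | no _ | yes refl = swap-a′
      ... | no v≢a′ | no v≢b = trans (swap-inner (inner-p₁ (inner-of Wv v≢a′ v≢b))) (p₁-involutive v)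

      swap-edge : ∀ {v} → W v ≡ true → Adj G v (swap v) ≡ true
      swap-edge {v} Wv with v ≟ a′ | v ≟ b
      ... | yes refl | _ = a′b
      ... | no _ | yes refl = trans (symmetric G b a′) a′b
      ... | no v≢a′ | no v≢b = let (v≢a , v≢c , _) = inner-avoids (inner-of Wv v≢a′ v≢b) in
                                addEdge-⊆-away G (p₁-edge v) v≢a v≢c

      matching : PerfectMatching G
      matching = splice G W swap p₂ W-closed-swap swap-involutive swap-edge
                   W-closed-p₂ p₂-involutive (p₂-edge-outside W (W-walk z≤n refl) (W-walk (s≤s z≤n) p₂b≡d))

  exchange : PerfectMatching G
  exchange with first-≤ (hit? ∘ walk ∘ suc) n
  ... | inj₂ never = ⊥-elim (walk-not-injective (suc n) (n≤1+n n)
                       (walk-injective (suc n) λ m<1+n e → never (≤-pred m<1+n) (inj₂ (inj₁ e))))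
  ... | inj₁ (k₀ , _ , inj₁ reaches-a , before) =
    FirstHit.ReachesAC.matching k₀ before (inj₁ refl) (inj₂ refl) p₁a≡c ab reaches-a
  ... | inj₁ (k₀ , _ , inj₂ (inj₁ returns) , before) =
    FirstHit.ReturnsToB.matching k₀ before returns
  ... | inj₁ (k₀ , _ , inj₂ (inj₂ reaches-c) , before) =
    FirstHit.ReachesAC.matching k₀ before (inj₂ refl) (inj₁ refl) p₁c≡a (trans (symmetric G c b) bc) reaches-c

perfectMatching-exchange : ∀ {n} (G : SimpleGraph n) {a b c d : Fin n} {a≢c : ¬ a ≡ c} {b≢d : ¬ b ≡ d} →
  Adj G a b ≡ true → Adj G b c ≡ true →
  PerfectMatching (addEdge G a c a≢c) → PerfectMatching (addEdge G b d b≢d) → PerfectMatching G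
perfectMatching-exchange G {a} {b} {c} {d} ab bc M₁ M₂
  with PerfectMatching.partner M₁ a ≟ c | PerfectMatching.partner M₂ b ≟ d
... | no p₁a≢c | _ = perfectMatching-addEdge⁻ G M₁ p₁a≢c
... | yes _ | no p₂b≢d = perfectMatching-addEdge⁻ G M₂ p₂b≢d
... | yes p₁a≡c | yes p₂b≡d = Exchange.exchange G ab bc M₁ M₂ p₁a≡c p₂b≡d

-- Perfect matchings from partitions into even cliques

∈-filterᵇ⁻ : ∀ {A : Set} (P : A → Bool) xs {v} → v ∈ filter (T? ∘ P) xs → P v ≡ true
∈-filterᵇ⁻ P xs v∈ = Equivalence.to T-≡ (proj₂ (∈-filter⁻ (T? ∘ P) {xs = xs} v∈))

module _ {n : ℕ} where

  occurrences : Fin n → List (Fin n) → ℕ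
  occurrences v [] = 0
  occurrences v (x ∷ xs) = 𝟙 (x ≡ᵇ v) + occurrences v xs

  occurrences-++ : ∀ v xs ys → occurrences v (xs ++ ys) ≡ occurrences v xs + occurrences v ys
  occurrences-++ v [] ys = refl
  occurrences-++ v (x ∷ xs) ys = trans (cong (𝟙 (x ≡ᵇ v) +_) (occurrences-++ v xs ys)) (sym (+-assoc (𝟙 (x ≡ᵇ v)) _ _))

  occurrences-∈ : ∀ {v xs} → v ∈ xs → 1 ≤ occurrences v xs
  occurrences-∈ {v} (here refl) rewrite ≡ᵇ-refl v = s≤s z≤n
  occurrences-∈ {v} {x ∷ xs} (there v∈xs) = ≤-trans (occurrences-∈ v∈xs) (m≤n+m _ (𝟙 (x ≡ᵇ v)))

  occurrences-take+drop : ∀ k v xs → occurrences v (take k xs) + occurrences v (drop k xs) ≡ occurrences v xs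
  occurrences-take+drop k v xs =
    trans (sym (occurrences-++ v (take k xs) (drop k xs))) (cong (occurrences v) (take++drop≡id k xs))

  occurrences-filter-tabulate : ∀ {m} (P : Fin n → Bool) (f : Fin m → Fin n) v →
    occurrences v (filter (T? ∘ P) (tabulate f)) ≡ sum (λ i → 𝟙 (P (f i) ∧ f i ≡ᵇ v))
  occurrences-filter-tabulate {zero} P f v = refl
  occurrences-filter-tabulate {suc m} P f v with P (f zero)
  ... | true = cong (𝟙 (f zero ≡ᵇ v) +_) (occurrences-filter-tabulate P (f ∘ suc) v)
  ... | false = occurrences-filter-tabulate P (f ∘ suc) v

  occurrences-filter : ∀ (P : Fin n → Bool) v → occurrences v (filter (T? ∘ P) (allFin n)) ≡ 𝟙 (P v)
  occurrences-filter P v = begin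
    occurrences v (filter (T? ∘ P) (allFin n))   ≡⟨ occurrences-filter-tabulate P id v ⟩
    sum (λ i → 𝟙 (P i ∧ i ≡ᵇ v))                 ≡⟨ sum-cong-≗ at-v ⟩
    sum (λ i → 𝟙 (P v) * 𝟙 (i ≡ᵇ v))             ≡⟨ *-distribˡ-sum {n} (𝟙 (P v)) _ ⟨
    𝟙 (P v) * sum (λ i → 𝟙 (i ≡ᵇ v))             ≡⟨ cong (𝟙 (P v) *_) (∑-δ v) ⟩
    𝟙 (P v) * 1                                  ≡⟨ *-identityʳ _ ⟩
    𝟙 (P v)                                      ∎
    where
    open ≡-Reasoning
    at-v : ∀ i → 𝟙 (P i ∧ i ≡ᵇ v) ≡ 𝟙 (P v) * 𝟙 (i ≡ᵇ v)
    at-v i with i ≟ v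
    ... | yes refl = 𝟙-∧ (P i) true
    ... | no _ = trans (cong 𝟙 (∧-zeroʳ (P i))) (sym (*-zeroʳ (𝟙 (P v))))

  pairUp : List (Fin n) → List (Fin n × Fin n)
  pairUp (x ∷ y ∷ xs) = (x , y) ∷ pairUp xs
  pairUp _ = []

  unpair : List (Fin n × Fin n) → List (Fin n)
  unpair [] = []
  unpair ((x , y) ∷ ps) = x ∷ y ∷ unpair ps

  unpair-++ : ∀ ps qs → unpair (ps ++ qs) ≡ unpair ps ++ unpair qs
  unpair-++ [] qs = refl
  unpair-++ ((x , y) ∷ ps) qs = cong (λ zs → x ∷ y ∷ zs) (unpair-++ ps qs)

  unpair-pairUp : ∀ xs → isOdd (length xs) ≡ false → unpair (pairUp xs) ≡ xs
  unpair-pairUp [] _ = refl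
  unpair-pairUp (x ∷ y ∷ xs) even = cong (λ zs → x ∷ y ∷ zs) (unpair-pairUp xs (trans (sym (not-involutive _)) even))

  pairUp-∈ : ∀ xs {x y} → (x , y) ∈ pairUp xs → x ∈ xs × y ∈ xs
  pairUp-∈ (x ∷ y ∷ xs) (here refl) = here refl , there (here refl)
  pairUp-∈ (x ∷ y ∷ xs) (there p∈) = let (x∈ , y∈) = pairUp-∈ xs p∈ in there (there x∈) , there (there y∈)

  unpair-∈ : ∀ ps {x y} → (x , y) ∈ ps → x ∈ unpair ps × y ∈ unpair ps
  unpair-∈ ((x , y) ∷ ps) (here refl) = here refl , there (here refl)
  unpair-∈ (_ ∷ ps) (there p∈) = let (x∈ , y∈) = unpair-∈ ps p∈ in there (there x∈) , there (there y∈)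

  pairUpAll : List (List (Fin n)) → List (Fin n × Fin n)
  pairUpAll = concatMap pairUp

  pairUpAll-∈ : ∀ bs {p} → p ∈ pairUpAll bs → ∃ λ b → b ∈ bs × p ∈ pairUp b
  pairUpAll-∈ (b ∷ bs) p∈ with ∈-++⁻ (pairUp b) p∈
  ... | inj₁ p∈b = b , here refl , p∈b
  ... | inj₂ p∈bs = let (b′ , b′∈ , p∈b′) = pairUpAll-∈ bs p∈bs in b′ , there b′∈ , p∈b′

  unpair-pairUpAll : ∀ bs → (∀ {b} → b ∈ bs → isOdd (length b) ≡ false) → unpair (pairUpAll bs) ≡ concat bs
  unpair-pairUpAll [] _ = refl
  unpair-pairUpAll (b ∷ bs) even = trans (unpair-++ (pairUp b) (pairUpAll bs))
    (cong₂ _++_ (unpair-pairUp b (even (here refl))) (unpair-pairUpAll bs (even ∘ there)))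

  partnerIn : List (Fin n × Fin n) → Fin n → Fin n
  partnerIn [] v = v
  partnerIn ((x , y) ∷ ps) v = if x ≡ᵇ v then y else (if y ≡ᵇ v then x else partnerIn ps v)

  AtMostOnce : List (Fin n × Fin n) → Set
  AtMostOnce ps = ∀ v → occurrences v (unpair ps) ≤ 1

  private
    absent-if-later : ∀ {b} m → 𝟙 b + m ≤ 1 → 1 ≤ m → b ≡ false
    absent-if-later {false} _ _ _ = refl
    absent-if-later {true} m (s≤s m≤0) 1≤m with ≤-trans 1≤m m≤0
    ... | ()

  head-absent : ∀ x′ y′ ps → AtMostOnce ((x′ , y′) ∷ ps) → ∀ {v} → 1 ≤ occurrences v (unpair ps) →
                ((x′ ≡ᵇ v) ≡ false) × ((y′ ≡ᵇ v) ≡ false)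
  head-absent x′ y′ ps once {v} 1≤ =
      absent-if-later (𝟙 (y′ ≡ᵇ v) + occurrences v (unpair ps)) (once v) (≤-trans 1≤ (m≤n+m _ _))
    , absent-if-later (occurrences v (unpair ps)) (≤-trans (m≤n+m _ (𝟙 (x′ ≡ᵇ v))) (once v)) 1≤

  atMostOnce-tail : ∀ x y ps → AtMostOnce ((x , y) ∷ ps) → AtMostOnce ps
  atMostOnce-tail x y ps once v =
    ≤-trans (m≤n+m _ (𝟙 (y ≡ᵇ v))) (≤-trans (m≤n+m _ (𝟙 (x ≡ᵇ v))) (once v))

  pair-≢ : ∀ ps → AtMostOnce ps → ∀ {x y} → (x , y) ∈ ps → ¬ x ≡ y
  pair-≢ ((x , y) ∷ ps) once (here refl) refl with once x
  ... | twice rewrite ≡ᵇ-refl x with twice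
  ... | s≤s ()
  pair-≢ ((x , y) ∷ ps) once (there p∈) = pair-≢ ps (atMostOnce-tail x y ps once) p∈

  partnerIn-later : ∀ x′ y′ ps → AtMostOnce ((x′ , y′) ∷ ps) → ∀ {v} → 1 ≤ occurrences v (unpair ps) →
                    partnerIn ((x′ , y′) ∷ ps) v ≡ partnerIn ps v
  partnerIn-later x′ y′ ps once {v} 1≤ with x′ ≟ v | y′ ≟ v | head-absent x′ y′ ps once 1≤
  ... | no _ | no _ | _ = refl
  ... | yes _ | _ | () , _
  ... | no _ | yes _ | _ , ()

  partnerIn-pair : ∀ ps → AtMostOnce ps → ∀ {x y} → (x , y) ∈ ps → partnerIn ps x ≡ y × partnerIn ps y ≡ x
  partnerIn-pair ((x , y) ∷ ps) once (here refl)
    rewrite ≡ᵇ-refl x | ≢⇒≡ᵇ-false (pair-≢ ((x , y) ∷ ps) once (here refl)) | ≡ᵇ-refl y = refl , refl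
  partnerIn-pair ((x′ , y′) ∷ ps) once (there p∈) =
    let x∈ , y∈ = unpair-∈ ps p∈
        x-later , y-later = partnerIn-pair ps (atMostOnce-tail x′ y′ ps once) p∈
    in trans (partnerIn-later x′ y′ ps once (occurrences-∈ x∈)) x-later ,
       trans (partnerIn-later x′ y′ ps once (occurrences-∈ y∈)) y-later

  pair-covering : ∀ ps v → 1 ≤ occurrences v (unpair ps) → ∃ λ u → (v , u) ∈ ps ⊎ (u , v) ∈ ps
  pair-covering ((x , y) ∷ ps) v 1≤ with x ≟ v | y ≟ v
  ... | yes refl | _ = y , inj₁ (here refl)
  ... | no _ | yes refl = x , inj₂ (here refl)
  ... | no _ | no _ with pair-covering ps v 1≤
  ...   | u , inj₁ p∈ = u , inj₁ (there p∈)
  ...   | u , inj₂ p∈ = u , inj₂ (there p∈)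

IsClique : ∀ {n} → SimpleGraph n → List (Fin n) → Set
IsClique G xs = ∀ {x y} → x ∈ xs → y ∈ xs → ¬ x ≡ y → Adj G x y ≡ true

perfectMatching-fromCliques : ∀ {n} (G : SimpleGraph n) (bs : List (List (Fin n))) →
  (∀ {b} → b ∈ bs → isOdd (length b) ≡ false) → (∀ {b} → b ∈ bs → IsClique G b) →
  (∀ v → occurrences v (concat bs) ≡ 1) → PerfectMatching G
perfectMatching-fromCliques G bs even clique once =
  record { partner = partnerIn ps ; isEdge = isEdge ; involutive = involutive }
  where
  ps = pairUpAll bs
  unpair-ps : unpair ps ≡ concat bs
  unpair-ps = unpair-pairUpAll bs even
  ps-once : AtMostOnce ps
  ps-once v rewrite unpair-ps | once v = ≤-refl
  pair-edge : ∀ {x y} → (x , y) ∈ ps → Adj G x y ≡ true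
  pair-edge p∈ with pairUpAll-∈ bs p∈
  ... | b , b∈ , p∈b = clique b∈ (proj₁ (pairUp-∈ b p∈b)) (proj₂ (pairUp-∈ b p∈b)) (pair-≢ ps ps-once p∈)
  covered : ∀ v → ∃ λ u → (v , u) ∈ ps ⊎ (u , v) ∈ ps
  covered v = pair-covering ps v (≤-reflexive (sym (trans (cong (occurrences v) unpair-ps) (once v))))
  involutive : ∀ v → partnerIn ps (partnerIn ps v) ≡ v
  involutive v with covered v
  ... | u , inj₁ p∈ rewrite proj₁ (partnerIn-pair ps ps-once p∈) = proj₂ (partnerIn-pair ps ps-once p∈)
  ... | u , inj₂ p∈ rewrite proj₂ (partnerIn-pair ps ps-once p∈) = proj₁ (partnerIn-pair ps ps-once p∈)
  isEdge : ∀ v → Adj G v (partnerIn ps v) ≡ true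
  isEdge v with covered v
  ... | u , inj₁ p∈ rewrite proj₁ (partnerIn-pair ps ps-once p∈) = pair-edge p∈
  ... | u , inj₂ p∈ rewrite proj₂ (partnerIn-pair ps ps-once p∈) = trans (symmetric G v u) (pair-edge p∈)

∈-take⁻ : ∀ {A : Set} k (xs : List A) {x} → x ∈ take k xs → x ∈ xs
∈-take⁻ k xs x∈ = subst (_ ∈_) (take++drop≡id k xs) (∈-++⁺ˡ x∈)

∈-drop⁻ : ∀ {A : Set} k (xs : List A) {x} → x ∈ drop k xs → x ∈ xs
∈-drop⁻ k xs x∈ = subst (_ ∈_) (take++drop≡id k xs) (∈-++⁺ʳ (take k xs) x∈)

Universal : ∀ {n} → SimpleGraph n → Fin n → Set
Universal G s = ∀ {w} → ¬ w ≡ s → Adj G s w ≡ true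

IsClique-++-universal : ∀ {n} {G : SimpleGraph n} {xs ys} → IsClique G xs → (∀ {s} → s ∈ ys → Universal G s) →
                        IsClique G (xs ++ ys)
IsClique-++-universal {G = G} {xs} clique universal x∈ y∈ x≢y with ∈-++⁻ xs x∈ | ∈-++⁻ xs y∈
... | inj₁ x∈xs | inj₁ y∈xs = clique x∈xs y∈xs x≢y
... | inj₁ _ | inj₂ y∈ys = trans (symmetric G _ _) (universal y∈ys x≢y)
... | inj₂ x∈ys | _ = universal x∈ys (x≢y ∘ sym)

module _ {n : ℕ} where

  oddCount : ∀ {m} → (Fin m → List (Fin n)) → ℕ
  oddCount C = sum λ i → 𝟙 (isOdd (length (C i)))

  evenUp : ∀ {m} → (Fin m → List (Fin n)) → List (Fin n) → List (List (Fin n))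
  evenUp {zero} C ss = ss ∷ []
  evenUp {suc m} C ss = if isOdd (length (C zero))
    then (C zero ++ take 1 ss) ∷ evenUp (C ∘ suc) (drop 1 ss)
    else C zero ∷ evenUp (C ∘ suc) ss

  occurrences-evenUp : ∀ {m} (C : Fin m → List (Fin n)) ss v →
    occurrences v (concat (evenUp C ss)) ≡ sum (λ i → occurrences v (C i)) + occurrences v ss
  occurrences-evenUp {zero} C ss v = trans (occurrences-++ v ss []) (+-identityʳ _)
  occurrences-evenUp {suc m} C ss v with isOdd (length (C zero))
  ... | true = begin
      occurrences v ((C zero ++ take 1 ss) ++ concat (evenUp (C ∘ suc) (drop 1 ss)))
    ≡⟨ occurrences-++ v (C zero ++ take 1 ss) _ ⟩
      occurrences v (C zero ++ take 1 ss) + occurrences v (concat (evenUp (C ∘ suc) (drop 1 ss)))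
    ≡⟨ cong₂ _+_ (occurrences-++ v (C zero) (take 1 ss)) (occurrences-evenUp (C ∘ suc) (drop 1 ss) v) ⟩
      (c₀ + occurrences v (take 1 ss)) + (rest + occurrences v (drop 1 ss))
    ≡⟨ interchange c₀ _ rest _ ⟩
      (c₀ + rest) + (occurrences v (take 1 ss) + occurrences v (drop 1 ss))
    ≡⟨ cong (c₀ + rest +_) (occurrences-take+drop 1 v ss) ⟩
      c₀ + rest + occurrences v ss
    ∎
    where
    open ≡-Reasoning
    c₀ = occurrences v (C zero)
    rest = sum λ i → occurrences v (C (suc i))
  ... | false = begin
      occurrences v (C zero ++ concat (evenUp (C ∘ suc) ss))
    ≡⟨ occurrences-++ v (C zero) _ ⟩
      occurrences v (C zero) + occurrences v (concat (evenUp (C ∘ suc) ss))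
    ≡⟨ cong (occurrences v (C zero) +_) (occurrences-evenUp (C ∘ suc) ss v) ⟩
      occurrences v (C zero) + (sum (λ i → occurrences v (C (suc i))) + occurrences v ss)
    ≡⟨ +-assoc (occurrences v (C zero)) _ _ ⟨
      occurrences v (C zero) + sum (λ i → occurrences v (C (suc i))) + occurrences v ss
    ∎
    where open ≡-Reasoning

  evenUp-even : ∀ {m} (C : Fin m → List (Fin n)) ss →
                oddCount C ≤ length ss → isOdd (length ss) ≡ isOdd (oddCount C) →
                ∀ {b} → b ∈ evenUp C ss → isOdd (length b) ≡ false
  evenUp-even {zero} C ss _ same (here refl) = same
  evenUp-even {suc m} C ss enough same b∈ with isOdd (length (C zero)) in odd₀
  evenUp-even {suc m} C [] () _ _ | true
  evenUp-even {suc m} C (s ∷ ss) _ _ (here refl) | true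
    rewrite length-++ (C zero) {s ∷ []} | isOdd-+ (length (C zero)) 1 | odd₀ = refl
  evenUp-even {suc m} C (s ∷ ss) (s≤s enough) same (there b∈) | true =
    evenUp-even (C ∘ suc) ss enough (not-injective same) b∈
  evenUp-even {suc m} C ss enough same (here refl) | false = odd₀
  evenUp-even {suc m} C ss enough same (there b∈) | false = evenUp-even (C ∘ suc) ss enough same b∈

  evenUp-clique : ∀ {m} {G : SimpleGraph n} (C : Fin m → List (Fin n)) ss → (∀ i → IsClique G (C i)) →
                  (∀ {s} → s ∈ ss → Universal G s) → ∀ {b} → b ∈ evenUp C ss → IsClique G b
  evenUp-clique {zero} {G} C ss _ universal (here refl) = IsClique-++-universal {G = G} {xs = []} (λ ()) universal
  evenUp-clique {suc m} {G} C ss clique universal b∈ with isOdd (length (C zero))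
  ... | true with b∈
  ...   | here refl = IsClique-++-universal {G = G} (clique zero) (universal ∘ ∈-take⁻ 1 ss)
  ...   | there b∈′ = evenUp-clique {G = G} (C ∘ suc) (drop 1 ss) (clique ∘ suc) (universal ∘ ∈-drop⁻ 1 ss) b∈′
  evenUp-clique {suc m} {G} C ss clique universal b∈ | false with b∈
  ...   | here refl = clique zero
  ...   | there b∈′ = evenUp-clique {G = G} (C ∘ suc) ss (clique ∘ suc) universal b∈′

perfectMatching-cliqueClasses : ∀ {n} (G : SimpleGraph n) (S : Fin n → Bool) (label : Fin n → Fin n) →
  (∀ {s} → S s ≡ true → Universal G s) →
  (∀ {u v} → S u ≡ false → S v ≡ false → label u ≡ label v → ¬ u ≡ v → Adj G u v ≡ true) →
  isOdd n ≡ false → oddClassCount S label ≤ card S → PerfectMatching G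
perfectMatching-cliqueClasses {n} G S label S-universal class-clique n-even few =
  perfectMatching-fromCliques G (evenUp classList SList)
    (evenUp-even classList SList enough same)
    (evenUp-clique {G = G} classList SList classList-clique (S-universal ∘ ∈-filterᵇ⁻ S (allFin n)))
    once
  where
  classList : Fin n → List (Fin n)
  classList i = filter (T? ∘ inClass S label i) (allFin n)
  SList : List (Fin n)
  SList = filter (T? ∘ S) (allFin n)
  oddCount≡ : oddCount classList ≡ oddClassCount S label
  oddCount≡ = sum-cong-≗ λ i → cong (𝟙 ∘ isOdd) (length-filter-tabulate (inClass S label i) id)
  length-SList : length SList ≡ card S
  length-SList = length-filter-tabulate S id
  enough : oddCount classList ≤ length SList
  enough = subst₂ _≤_ (sym oddCount≡) (sym length-SList) few
  same : isOdd (length SList) ≡ isOdd (oddCount classList)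
  same = trans (cong isOdd length-SList)
    (trans (xor≡false⇒≡ (trans (sym (isOdd-card+oddClassCount S label)) n-even)) (cong isOdd (sym oddCount≡)))
  classList-clique : ∀ i → IsClique G (classList i)
  classList-clique i x∈ y∈ x≢y =
    let (Sx , lx) = inClass⇒ S label (∈-filterᵇ⁻ (inClass S label i) (allFin n) x∈)
        (Sy , ly) = inClass⇒ S label (∈-filterᵇ⁻ (inClass S label i) (allFin n) y∈)
    in class-clique Sx Sy (trans lx (sym ly)) x≢y
  once : ∀ v → occurrences v (concat (evenUp classList SList)) ≡ 1
  once v = begin
    occurrences v (concat (evenUp classList SList))
      ≡⟨ occurrences-evenUp classList SList v ⟩
    sum (λ i → occurrences v (classList i)) + occurrences v SList
      ≡⟨ cong₂ _+_ (sum-cong-≗ λ i → occurrences-filter (inClass S label i) v) (occurrences-filter S v) ⟩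
    sum (λ i → 𝟙 (inClass S label i v)) + 𝟙 (S v)
      ≡⟨ cong (_+ 𝟙 (S v)) (inClass-unique S label v) ⟩
    𝟙 (not (S v)) + 𝟙 (S v)
      ≡⟨ trans (+-comm (𝟙 (not (S v))) _) (𝟙+𝟙-not (S v)) ⟩
    1 ∎
    where open ≡-Reasoning

-- Tutte's theorem, following Lovász's proof

first : ∀ {n} → (Fin n → Bool) → Maybe (Fin n)
first {zero} P = nothing
first {suc n} P = if P zero then just zero else Maybe.map suc (first (P ∘ suc))

first-cong : ∀ {n} {P Q : Fin n → Bool} → (∀ x → P x ≡ Q x) → first P ≡ first Q
first-cong {zero} _ = refl
first-cong {suc n} P≗Q rewrite P≗Q zero | first-cong (P≗Q ∘ suc) = refl

first-sound : ∀ {n} (P : Fin n → Bool) {w} → first P ≡ just w → P w ≡ true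
first-sound {suc n} P e with P zero in P₀ | first (P ∘ suc) in e′
first-sound {suc n} P refl | true | _ = P₀
first-sound {suc n} P refl | false | just _ = first-sound (P ∘ suc) e′

first-complete : ∀ {n} (P : Fin n → Bool) {v} → P v ≡ true → ∃ λ w → first P ≡ just w
first-complete {suc n} P {v} Pv with P zero in P₀ | first (P ∘ suc) in e′
... | true | _ = zero , refl
... | false | just w = suc w , refl
first-complete {suc n} P {zero} Pv | false | nothing with trans (sym Pv) P₀
... | ()
first-complete {suc n} P {suc v} Pv | false | nothing with first-complete (P ∘ suc) Pv
... | _ , e″ with trans (sym e′) e″
... | ()

module _ {n} (G : SimpleGraph n) where

  NonNeighbour : Fin n → Fin n → Set
  NonNeighbour v w = ¬ w ≡ v × Adj G v w ≡ false

  nonNeighbour? : ∀ v → Dec (∃ (NonNeighbour v))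
  nonNeighbour? v = Finₚ.any? λ w → ¬? (w ≟ v) ×-dec Adj G v w Data.Bool.≟ false

  isUniversal : Fin n → Bool
  isUniversal v = not (does (nonNeighbour? v))

  isUniversal⇒Universal : ∀ {s} → isUniversal s ≡ true → Universal G s
  isUniversal⇒Universal {s} e {w} w≢s with nonNeighbour? s
  ... | no none = ¬-not λ Asw≡false → none (w , w≢s , Asw≡false)

  nonNeighbour : ∀ {v} → isUniversal v ≡ false → ∃ (NonNeighbour v)
  nonNeighbour {v} e with nonNeighbour? v
  ... | yes nn = nn

  InducedPath : Fin n → Fin n → Fin n → Set
  InducedPath a b c = Adj G a b ≡ true × Adj G b c ≡ true × ¬ a ≡ c × Adj G a c ≡ false

  NonUniversalInducedPath : Set
  NonUniversalInducedPath = ∃ λ a → ∃ λ b → ∃ λ c →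
    isUniversal a ≡ false × isUniversal b ≡ false × isUniversal c ≡ false × InducedPath a b c

  nonUniversalInducedPath? : Dec NonUniversalInducedPath
  nonUniversalInducedPath? =
    Finₚ.any? λ a → Finₚ.any? λ b → Finₚ.any? λ c →
      isUniversal a Data.Bool.≟ false ×-dec isUniversal b Data.Bool.≟ false ×-dec isUniversal c Data.Bool.≟ false ×-dec
      Adj G a b Data.Bool.≟ true ×-dec Adj G b c Data.Bool.≟ true ×-dec ¬? (a ≟ c) ×-dec Adj G a c Data.Bool.≟ false

  -- Without such a path, "equal or adjacent" is an equivalence on the non-universal vertices,
  -- so the components of G − S are cliques and are labelled by their first vertex.
  module NoInducedPath (no-path : ¬ NonUniversalInducedPath) where

    near : Fin n → Fin n → Bool
    near u v = u ≡ᵇ v ∨ Adj G u v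

    near-sym : ∀ u v → near u v ≡ near v u
    near-sym u v = cong₂ _∨_ (≡ᵇ-sym u v) (symmetric G u v)

    near-trans : ∀ {u v w} → isUniversal u ≡ false → isUniversal v ≡ false → isUniversal w ≡ false →
                 near u v ≡ true → near v w ≡ true → near u w ≡ true
    near-trans {u} {v} {w} su sv sw uv vw with u ≟ v
    ... | yes refl = vw
    ... | no _ with v ≟ w
    ...   | yes refl = trans (cong (does (u ≟ v) ∨_) uv) (∨-zeroʳ _)
    ...   | no _ with u ≟ w
    ...     | yes _ = refl
    ...     | no u≢w with Adj G u w in uw
    ...       | true = refl
    ...       | false = ⊥-elim (no-path (u , v , w , su , sv , sw , uv , vw , u≢w , uw))

    mate : Fin n → Fin n → Bool
    mate v w = not (isUniversal w) ∧ near w v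

    label : Fin n → Fin n
    label v = fromMaybe v (first (mate v))

    label-found : ∀ {v} → isUniversal v ≡ false → ∃ λ w → first (mate v) ≡ just w
    label-found {v} sv = first-complete (mate v) (cong₂ _∧_ (cong not sv) (cong (_∨ _) (≡ᵇ-refl v)))

    label-spec : ∀ {v} → isUniversal v ≡ false → isUniversal (label v) ≡ false × near (label v) v ≡ true
    label-spec {v} sv with label-found sv
    ... | w , found rewrite found =
      let mate-w = first-sound (mate v) found in not-injective (∧-conicalˡ _ _ mate-w) , ∧-conicalʳ _ _ mate-w

    label-cong : ∀ {u v} → isUniversal u ≡ false → isUniversal v ≡ false → near u v ≡ true → label u ≡ label v
    label-cong {u} {v} su sv uv = trans (cong (fromMaybe u) (first-cong same-mates)) (fromMaybe-found (label-found sv))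
      where
      same-mates : ∀ w → mate u w ≡ mate v w
      same-mates w with isUniversal w in sw
      ... | true = refl
      ... | false with near w u in wu | near w v in wv
      ...   | true | true = refl
      ...   | false | false = refl
      ...   | true | false = trans (sym (near-trans sw su sv wu uv)) wv
      ...   | false | true = trans (sym wu) (near-trans sw sv su wv (trans (near-sym v u) uv))
      fromMaybe-found : (∃ λ w → first (mate v) ≡ just w) → fromMaybe u (first (mate v)) ≡ label v
      fromMaybe-found (_ , found) rewrite found = refl

    label-near : ∀ {u v} → isUniversal u ≡ false → isUniversal v ≡ false → label u ≡ label v → near u v ≡ true
    label-near {u} {v} su sv same =
      let (sl , lu) = label-spec su
          (_ , lv) = label-spec sv
      in near-trans su sl sv (trans (near-sym u (label u)) lu) (subst (λ l → near l v ≡ true) (sym same) lv)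

    class-clique : ∀ {u v} → isUniversal u ≡ false → isUniversal v ≡ false → label u ≡ label v → ¬ u ≡ v →
                   Adj G u v ≡ true
    class-clique {u} {v} su sv same u≢v = subst (λ b → b ∨ Adj G u v ≡ true) (≢⇒≡ᵇ-false u≢v) (label-near su sv same)

    matchingOrBarrier : isOdd n ≡ false → PerfectMatching G ⊎ Barrier G
    matchingOrBarrier even with oddClassCount isUniversal label ≤? card isUniversal
    ... | yes few = inj₁ (perfectMatching-cliqueClasses G isUniversal label isUniversal⇒Universal class-clique even few)
    ... | no many = inj₂ record
      { S = isUniversal ; label = label
      ; label-edge = λ u v su sv uv → label-cong su sv (trans (cong (u ≡ᵇ v ∨_) uv) (∨-zeroʳ _))
      ; card<oddClassCount = ≰⇒> many }

tutte-step : ∀ {n} (G : SimpleGraph n) → isOdd n ≡ false →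
  (∀ {x y} (x≢y : ¬ x ≡ y) → Adj G x y ≡ false → PerfectMatching (addEdge G x y x≢y) ⊎ Barrier (addEdge G x y x≢y)) →
  PerfectMatching G ⊎ Barrier G
tutte-step G even supergraph with nonUniversalInducedPath? G
... | no no-path = NoInducedPath.matchingOrBarrier G no-path even
... | yes (a , b , c , _ , sb , _ , ab , bc , a≢c , ¬ac) with nonNeighbour G sb
...   | d , d≢b , ¬bd with supergraph a≢c ¬ac | supergraph (d≢b ∘ sym) ¬bd
...     | inj₂ B | _ = inj₂ (barrier-addEdge⁻ G B)
...     | inj₁ _ | inj₂ B = inj₂ (barrier-addEdge⁻ G B)
...     | inj₁ M₁ | inj₁ M₂ = inj₁ (perfectMatching-exchange G ab bc M₁ M₂)

tutte-≤ : ∀ k {n} (G : SimpleGraph n) → isOdd n ≡ false → nonEdgeCount G ≤ k → PerfectMatching G ⊎ Barrier G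
tutte-≤ k G even bound = tutte-step G even λ x≢y ¬xy → recurse k (≤-trans (nonEdgeCount-addEdge G x≢y ¬xy) bound)
  where
  recurse : ∀ {x y} {x≢y : ¬ x ≡ y} k → nonEdgeCount (addEdge G x y x≢y) < k →
            PerfectMatching (addEdge G x y x≢y) ⊎ Barrier (addEdge G x y x≢y)
  recurse (suc k) lt = tutte-≤ k _ even (≤-pred lt)

tutte : ∀ {n} (G : SimpleGraph n) → isOdd n ≡ false → PerfectMatching G ⊎ Barrier G
tutte G even = tutte-≤ (nonEdgeCount G) G even ≤-refl

-- Barriers in regular graphs

quadratic-bound : ∀ e s r → 1 ≤ s → s ≤ r → s * suc r ≤ e + s * s → r ≤ e
quadratic-bound e s@(suc s′) r _ s≤r bound with m≤n⇒∃[o]m+o≡n s≤r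
... | m , refl = ≤-trans (subst (_≤ s * m + s) (+-comm m s) (+-monoˡ-≤ s (m≤m+n m (s′ * m)))) sm+s≤e
  where
  expand : s * suc (s + m) ≡ s * s + (s * m + s)
  expand = solve 2 (λ s m → s :* (con 1 :+ (s :+ m)) := s :* s :+ (s :* m :+ s)) refl s m
  sm+s≤e : s * m + s ≤ e
  sm+s≤e = +-cancelˡ-≤ (s * s) _ _ (subst₂ _≤_ expand (+-comm e (s * s)) bound)

<ᵇ≡true⇒< : ∀ {m n} → (m <ᵇ n) ≡ true → m < n
<ᵇ≡true⇒< {m} {n} e = <ᵇ⇒< m n (subst T (sym e) _)

<ᵇ≡false⇒≥ : ∀ {m n} → (m <ᵇ n) ≡ false → n ≤ m
<ᵇ≡false⇒≥ e = ≮⇒≥ λ m<n → subst T e (<⇒<ᵇ m<n)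

same-parity-< : ∀ {r s} → r < s → isOdd r ≡ isOdd s → 2 + r ≤ s
same-parity-< r<s same with m≤n⇒m<n∨m≡n r<s
... | inj₁ 1+r<s = 1+r<s
... | inj₂ refl = ⊥-elim (not-¬ refl same)

three-big : ∀ r B → 3 ≤ r → r * 2 + B ≤ r * B → 3 ≤ B
three-big r zero 3≤r bound = ⊥-elim (n≮0 (≤-trans (≤-trans (s≤s z≤n) 3≤r) (≤-trans (m≤m*n r 2)
  (≤-trans (≤-reflexive (sym (+-identityʳ (r * 2)))) (≤-trans bound (≤-reflexive (*-zeroʳ r)))))))
three-big r B@(suc _) 3≤r bound = *-cancelˡ-< r 2 B (<-≤-trans (m<m+n (r * 2) (s≤s z≤n)) bound)

barrier-arithmetic : ∀ {r n s B E O} → 3 ≤ r → r * O + B ≤ E + r * B → O ≤ E → s + (2 + r) * B ≤ n →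
                     E ≤ r * s → s + 2 ≤ O → 3 * r + 7 ≤ n
barrier-arithmetic {r} {n} {s} {B} {E} {O} 3≤r odd-bound O≤E size-bound E≤rs s+2≤O = begin
  3 * r + 7              ≡⟨ solve 1 (λ r → con 3 :* r :+ con 7 := con 1 :+ (con 2 :+ r) :* con 3) refl r ⟩
  1 + (2 + r) * 3        ≤⟨ +-mono-≤ 1≤s (*-monoʳ-≤ (2 + r) (three-big r B 3≤r (+-cancelˡ-≤ (r * s) _ _ chain))) ⟩
  s + (2 + r) * B        ≤⟨ size-bound ⟩
  n                      ∎
  where
  open ≤-Reasoning
  chain : r * s + (r * 2 + B) ≤ r * s + r * B
  chain = begin
    r * s + (r * 2 + B)  ≡⟨ +-assoc (r * s) _ _ ⟨
    r * s + r * 2 + B    ≡⟨ cong (_+ B) (*-distribˡ-+ r s 2) ⟨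
    r * (s + 2) + B      ≤⟨ +-monoˡ-≤ B (*-monoʳ-≤ r s+2≤O) ⟩
    r * O + B            ≤⟨ odd-bound ⟩
    E + r * B            ≤⟨ +-monoˡ-≤ (r * B) E≤rs ⟩
    r * s + r * B        ∎
  1≤s : 1 ≤ s
  1≤s = positive s E≤rs s+2≤O
    where
    positive : ∀ s → E ≤ r * s → s + 2 ≤ O → 1 ≤ s
    positive zero E≤0 2≤O = ⊥-elim (n≮0 (≤-trans 2≤O (≤-trans O≤E (≤-trans E≤0 (≤-reflexive (*-zeroʳ r))))))
    positive (suc _) _ _ = s≤s z≤n

module RegularBarrier {n} (G : SimpleGraph n) (r : ℕ) (r-odd : isOdd r ≡ true) (regular : IsRegular r G)
                      (B : Barrier G) where

  open Barrier B

  A : Fin n → Fin n → ℕ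
  A v w = 𝟙 (Adj G v w)

  degree≡r : ∀ v → sum (A v) ≡ r
  degree≡r v = trans (sym (degree≡∑ G v)) (regular v)

  member : Fin n → Fin n → ℕ
  member i v = 𝟙 (inClass S label i v)

  size : Fin n → ℕ
  size = classSize S label

  toS : Fin n → ℕ
  toS v = sum λ s → 𝟙 (S s) * A v s

  within : Fin n → Fin n → ℕ
  within i v = sum λ w → member i w * A v w

  inside : Fin n → ℕ
  inside i = sum λ v → member i v * within i v

  crossing : Fin n → ℕ
  crossing i = sum λ v → member i v * toS v

  neighbour-in-class-or-S : ∀ {i v} → inClass S label i v ≡ true → ∀ w → A v w ≡ member i w * A v w + 𝟙 (S w) * A v w
  neighbour-in-class-or-S {i} {v} v∈i w with inClass⇒ S label v∈i
  ... | Sv , lv with S w in Sw | label w ≟ i | Adj G v w in vw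
  ... | true | _ | x = sym (+-identityʳ (𝟙 x))
  ... | false | yes _ | x = sym (trans (+-identityʳ (𝟙 x + 0)) (+-identityʳ (𝟙 x)))
  ... | false | no _ | false = refl
  ... | false | no lw≢i | true = ⊥-elim (lw≢i (trans (sym (label-edge v w Sv Sw vw)) lv))

  degree-split : ∀ {i v} → inClass S label i v ≡ true → within i v + toS v ≡ r
  degree-split {i} {v} v∈i = begin
    within i v + toS v                                   ≡⟨ ∑-distrib-+ (λ w → member i w * A v w) _ ⟨
    sum (λ w → member i w * A v w + 𝟙 (S w) * A v w)     ≡⟨ sum-cong-≗ (neighbour-in-class-or-S v∈i) ⟨
    sum (A v)                                            ≡⟨ degree≡r v ⟩
    r                                                    ∎
    where open ≡-Reasoning

  handshake : ∀ i → r * size i ≡ inside i + crossing i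
  handshake i = begin
    r * size i                                                    ≡⟨ *-distribˡ-sum {n} r (member i) ⟩
    sum (λ v → r * member i v)                                    ≡⟨ sum-cong-≗ at ⟩
    sum (λ v → member i v * within i v + member i v * toS v)      ≡⟨ ∑-distrib-+ (λ v → member i v * within i v) _ ⟩
    inside i + crossing i              ∎
    where
    open ≡-Reasoning
    at : ∀ v → r * member i v ≡ member i v * within i v + member i v * toS v
    at v with inClass S label i v in v∈i
    ... | false = *-zeroʳ r
    ... | true = trans (*-identityʳ r) (trans (sym (degree-split v∈i))
                   (sym (cong₂ _+_ (*-identityˡ (within i v)) (*-identityˡ (toS v)))))

  inside-even : ∀ i → isOdd (inside i) ≡ false
  inside-even i = trans (cong isOdd (sum-cong-≗ λ v → *-distribˡ-sum {n} (member i v) (λ w → member i w * A v w)))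
    (∑∑-symmetric-even (λ v w → member i v * (member i w * A v w))
      (λ v w → trans (x∙yz≈y∙xz (member i v) (member i w) (A v w))
                     (cong (λ b → member i w * (member i v * 𝟙 b)) (symmetric G v w)))
      (λ v → trans (cong (λ b → member i v * (member i v * 𝟙 b)) (loopless G v))
                   (trans (cong (member i v *_) (*-zeroʳ (member i v))) (*-zeroʳ (member i v)))))

  isOdd-crossing : ∀ i → isOdd (crossing i) ≡ isOdd (size i)
  isOdd-crossing i = sym (begin
    isOdd (size i)                                            ≡⟨ cong (_∧ isOdd (size i)) r-odd ⟨
    isOdd r ∧ isOdd (size i)                                  ≡⟨ isOdd-* r (size i) ⟨
    isOdd (r * size i)                                        ≡⟨ cong isOdd (handshake i) ⟩
    isOdd (inside i + crossing i)  ≡⟨ isOdd-+ (inside i) (crossing i) ⟩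
    isOdd (inside i) xor isOdd (crossing i) ≡⟨ cong (_xor isOdd (crossing i)) (inside-even i) ⟩
    isOdd (crossing i)                                        ∎)
    where open ≡-Reasoning

  within<size : ∀ {i v} → inClass S label i v ≡ true → within i v < size i
  within<size {i} {v} v∈i =
    subst (_≤ size i)
      (trans (∑-distrib-+ (λ w → 𝟙 (w ≡ᵇ v)) (λ w → member i w * A v w)) (cong (_+ within i v) (∑-δ v)))
      (∑-mono-≤ at)
    where
    at : ∀ w → 𝟙 (w ≡ᵇ v) + member i w * A v w ≤ member i w
    at w with w ≟ v
    ... | yes refl rewrite loopless G w | v∈i = ≤-refl
    ... | no _ = ≤-trans (*-monoʳ-≤ (member i w) (𝟙≤1 (Adj G v w))) (≤-reflexive (*-identityʳ (member i w)))

  small-odd-class : ∀ i → isOdd (size i) ≡ true → size i ≤ r → r ≤ crossing i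
  small-odd-class i odd size≤r = quadratic-bound (crossing i) (size i) r (isOdd⇒0< odd) size≤r
    (subst₂ _≤_ (∑-*ʳ (member i) (suc r))
       (trans (∑-distrib-+ (λ v → member i v * toS v) _) (cong (crossing i +_) (∑-*ʳ (member i) (size i))))
       (∑-mono-≤ at))
    where
    at : ∀ v → member i v * suc r ≤ member i v * toS v + member i v * size i
    at v with inClass S label i v in v∈i
    ... | false = z≤n
    ... | true rewrite *-identityˡ (suc r) | *-identityˡ (toS v) | *-identityˡ (size i) = begin
      suc r                     ≡⟨ cong suc (degree-split v∈i) ⟨
      suc (within i v + toS v)  ≡⟨ cong suc (+-comm (within i v) (toS v)) ⟩
      suc (toS v + within i v)  ≡⟨ +-suc (toS v) (within i v) ⟨
      toS v + suc (within i v)  ≤⟨ +-monoʳ-≤ (toS v) (within<size v∈i) ⟩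
      toS v + size i            ∎
      where open ≤-Reasoning

  ∑crossing≤ : sum crossing ≤ r * card S
  ∑crossing≤ = begin
    sum crossing                                   ≡⟨ ∑-comm (λ i v → member i v * toS v) ⟩
    sum (λ v → sum λ i → member i v * toS v)       ≡⟨ sum-cong-≗ (λ v → ∑-*ʳ (λ i → member i v) (toS v)) ⟩
    sum (λ v → sum (λ i → member i v) * toS v)     ≡⟨ sum-cong-≗ (λ v → cong (_* toS v) (inClass-unique S label v)) ⟩
    sum (λ v → 𝟙 (not (S v)) * toS v)              ≤⟨ ∑-mono-≤ (λ v → 𝟙*-≤ (not (S v)) (toS v)) ⟩
    sum toS                                        ≡⟨ ∑-comm (λ v s → 𝟙 (S s) * A v s) ⟩
    sum (λ s → sum λ v → 𝟙 (S s) * A v s)          ≡⟨ sum-cong-≗ (λ s → *-distribˡ-sum {n} (𝟙 (S s)) (λ v → A v s)) ⟨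
    sum (λ s → 𝟙 (S s) * sum (λ v → A v s))        ≡⟨ sum-cong-≗ (λ s → cong (𝟙 (S s) *_) degree-into) ⟩
    sum (λ s → 𝟙 (S s) * r)                        ≡⟨ ∑-*ʳ (𝟙 ∘ S) r ⟩
    card S * r                                     ≡⟨ *-comm (card S) r ⟩
    r * card S                                     ∎
    where
    open ≤-Reasoning
    degree-into : ∀ {s} → sum (λ v → A v s) ≡ r
    degree-into {s} = trans (sum-cong-≗ (λ v → cong 𝟙 (symmetric G v s))) (degree≡r s)

  oddClass : Fin n → ℕ
  oddClass i = 𝟙 (isOdd (size i))

  bigOddClass : Fin n → ℕ
  bigOddClass i = 𝟙 (isOdd (size i) ∧ (r <ᵇ size i))

  oddClass-crossing : ∀ i → r * oddClass i + bigOddClass i ≤ oddClass i * crossing i + r * bigOddClass i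
  oddClass-crossing i with isOdd (size i) in odd | r <ᵇ size i in large
  ... | false | _ rewrite *-zeroʳ r = z≤n
  ... | true | true = subst₂ _≤_ (cong (_+ 1) (sym (*-identityʳ r)))
      (cong₂ _+_ (sym (+-identityʳ (crossing i))) (sym (*-identityʳ r)))
      (subst (_≤ crossing i + r) (+-comm 1 r) (+-monoˡ-≤ r (isOdd⇒0< (trans (isOdd-crossing i) odd))))
  ... | true | false = subst₂ _≤_ (sym (trans (+-identityʳ (r * 1)) (*-identityʳ r)))
      (sym (trans (cong₂ _+_ (+-identityʳ (crossing i)) (*-zeroʳ r)) (+-identityʳ (crossing i))))
      (small-odd-class i odd (<ᵇ≡false⇒≥ large))

  oddClass≤crossing : ∀ i → oddClass i ≤ oddClass i * crossing i
  oddClass≤crossing i with isOdd (size i) in odd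
  ... | false = z≤n
  ... | true = subst (1 ≤_) (sym (+-identityʳ (crossing i))) (isOdd⇒0< (trans (isOdd-crossing i) odd))

  bigOddClass-size : ∀ i → (2 + r) * bigOddClass i ≤ size i
  bigOddClass-size i with isOdd (size i) in odd | r <ᵇ size i in large
  ... | false | _ = ≤-trans (≤-reflexive (*-zeroʳ (2 + r))) z≤n
  ... | true | false = ≤-trans (≤-reflexive (*-zeroʳ (2 + r))) z≤n
  ... | true | true =
    ≤-trans (≤-reflexive (*-identityʳ (2 + r))) (same-parity-< (<ᵇ≡true⇒< large) (trans r-odd (sym odd)))

  regular-barrier-large : isOdd n ≡ false → 3 ≤ r → 3 * r + 7 ≤ n
  regular-barrier-large even 3≤r =
    barrier-arithmetic 3≤r odd-bound (∑-mono-≤ oddClass≤crossing) size-bound crossing-bound card+2≤odd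
    where
    E = sum λ i → oddClass i * crossing i
    big = sum bigOddClass
    odd-bound : r * oddClassCount S label + big ≤ E + r * big
    odd-bound = subst₂ _≤_
      (trans (∑-distrib-+ (λ i → r * oddClass i) bigOddClass) (cong (_+ big) (sym (*-distribˡ-sum {n} r oddClass))))
      (trans (∑-distrib-+ (λ i → oddClass i * crossing i) (λ i → r * bigOddClass i))
             (cong (E +_) (sym (*-distribˡ-sum {n} r bigOddClass))))
      (∑-mono-≤ oddClass-crossing)
    size-bound : card S + (2 + r) * big ≤ n
    size-bound = subst (card S + (2 + r) * big ≤_) (card+∑classSize S label)
      (+-monoʳ-≤ (card S)
        (subst (_≤ sum size) (sym (*-distribˡ-sum {n} (2 + r) bigOddClass)) (∑-mono-≤ bigOddClass-size)))
    crossing-bound : E ≤ r * card S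
    crossing-bound = ≤-trans (∑-mono-≤ (λ i → 𝟙*-≤ (isOdd (size i)) (crossing i))) ∑crossing≤
    card+2≤odd : card S + 2 ≤ oddClassCount S label
    card+2≤odd = subst (_≤ oddClassCount S label) (+-comm 2 (card S))
      (same-parity-< card<oddClassCount (xor≡false⇒≡ (trans (sym (isOdd-card+oddClassCount S label)) even)))

mainTheorem2 : (r n : ℕ) → 15 < r → ¬ (2 ∣ r) → 2 ∣ n → n < 3 * r + 7 →
    (G : SimpleGraph n) → IsRegular r G → PerfectMatching G
mainTheorem2 r n 15<r r-odd n-even n<3r+7 G regular with tutte G (2∣⇒isOdd≡false n-even)
... | inj₁ M = M
... | inj₂ B = ⊥-elim (<⇒≱ n<3r+7 (regular-barrier-large (2∣⇒isOdd≡false n-even) 3≤r))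
  where
  open RegularBarrier G r (¬2∣⇒isOdd r-odd) regular B
  -- the counting argument only needs r ≥ 3
  3≤r : 3 ≤ r
  3≤r = ≤-trans (s≤s (s≤s (s≤s z≤n))) 15<r
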